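{- Let $c\ge 1$, $n\ge1$, let $e_1,\dots,e_n$ be positive integers with $\sum_{i=1}^{n}e_{i}=k$, and let $u=I_{c}^{e_{1}}D_{c}^{e_{2}}I_{c}^{e_{3}}\ldots \mathcal{L}_{c}^{e_{n}}$, where $\mathcal{L}$ is $I$ if $n$ is odd and $D$ if $n$ is even. Then $\mathit{fw}(u)\leq c(k-e_{m})+2e_{m}-1$ for every $m\in\{1,\dots,n\}$.
   Context: A sequence $s$ contains a sequence $u$ if some subsequence of $s$ can be changed into $u$ by a one-to-one renaming of its letters. An $(r,s)$-formation is a concatenation of $s$ permutations of the same set of $r$ distinct letters. The formation width $\mathit{fw}(u)$ is the minimum $s$ such that there exists $r$ for which every $(r,s)$-formation contains $u$. $I_c$ denotes $1\,2\ldots c$, $D_c$ denotes $c\,(c-1)\ldots 1$; powers denote repeated concatenation. -}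

module Defs where

open import Data.Nat using (ℕ; zero; suc; _+_; _*_; _∸_; _≤_)
open import Data.Bool using (Bool; true; false; not)
open import Data.List using (List; []; _∷_; _++_; map; upTo; reverse; concat; replicate; length)
open import Data.List.Relation.Binary.Sublist.Propositional using (_⊆_)
open import Data.List.Relation.Unary.All using (All)
open import Data.List.Relation.Unary.Unique.Propositional using (Unique)
open import Data.List.Relation.Binary.Permutation.Propositional using (_↭_)
open import Data.List.Membership.Propositional using (_∈_)
open import Data.Product using (Σ; ∃; _×_; _,_)
open import Relation.Binary.PropositionalEquality using (_≡_)

Seq : Set
Seq = List ℕ

Contains : Seq → Seq → Set
Contains s u = Σ Seq λ w → (w ⊆ s) × Σ (ℕ → ℕ) λ f →
  ((∀ {x y} → x ∈ w → y ∈ w → f x ≡ f y → x ≡ y) × (map f w ≡ u))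

Formation : ℕ → ℕ → Seq → Set
Formation r s x = Σ Seq λ L → (length L ≡ r) × Unique L ×
  Σ (List Seq) λ ps → (length ps ≡ s) × All (_↭ L) ps × (x ≡ concat ps)

AllFormationsContain : ℕ → ℕ → Seq → Set
AllFormationsContain r s u = ∀ x → Formation r s x → Contains x u

-- fw(u) ≤ N, i.e. min { s | ∃ r. every (r,s)-formation contains u } ≤ N
FwAtMost : Seq → ℕ → Set
FwAtMost u N = Σ ℕ λ s → (s ≤ N) × ∃ λ r → AllFormationsContain r s u

I : ℕ → Seq
I c = map suc (upTo c)

D : ℕ → Seq
D c = reverse (I c)

pow : Seq → ℕ → Seq
pow w e = concat (replicate e w)

alt : ℕ → Bool → List ℕ → Seq
alt c b [] = []
alt c true  (e ∷ es) = pow (I c) e ++ alt c false es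
alt c false (e ∷ es) = pow (D c) e ++ alt c true es

altWord : ℕ → List ℕ → Seq
altWord c es = alt c true es

-- Write u = X · L^e · Y, where L^e is the block of exponent e = e_m (L = I_c or D_c) and the
-- alternating words X and Y have lengths c·Σ_{i<m} e_i and c·Σ_{i>m} e_i; cut a formation with
-- |X| + (2e − 1) + |Y| permutations into three blocks of these sizes. If r is large, iterating
-- Erdős–Szekeres over the 2e − 1 middle permutations yields c letters A that occur in each of
-- them either in the order A or in the reverse order; by pigeonhole e of them agree, so P^e occurs
-- in the middle block for P = A or P = reverse A. Renaming L letter by letter to P, the letters
-- of X and Y are found one per permutation in the outer blocks.
module Submission where

open import Defs
open import Algebra.Properties.CommutativeSemigroup using (x∙yz≈y∙xz)
open import Data.Bool using (Bool; true; false; not)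
open import Data.Empty using (⊥-elim)
open import Data.Fin using (Fin; zero; suc)
open import Data.List using (List; []; _∷_; _++_; map; reverse; concat; length; filter; take; drop; upTo)
open import Data.List.Membership.Propositional using (_∈_; _∉_)
open import Data.List.Membership.Propositional.Properties using (∈-∃++; ∈-++⁻; ∈-filter⁻; ∈-map⁻)
open import Data.List.Properties
  using (length-++; length-map; length-reverse; length-take; length-drop; length-upTo; take++drop≡id;
         map-++; map-∘; map-id-local; map-cong-local; ++-assoc; concat-++; unfold-reverse)
open import Data.List.Relation.Binary.Permutation.Propositional using (_↭_; ↭-sym; ↭⇒↭ₛ)
open import Data.List.Relation.Binary.Permutation.Propositional.Properties using (∈-resp-↭; ↭-reverse)
open import Data.List.Relation.Binary.Permutation.Setoid.Properties using (Unique-resp-↭)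
open import Data.List.Relation.Binary.Sublist.Propositional using (_⊆_; []; _∷_; _∷ʳ_; ⊆-trans; minimum; from∈)
import Data.List.Relation.Binary.Sublist.Propositional as Sublist
open import Data.List.Relation.Binary.Sublist.Propositional.Properties
  using (++⁺; ++⁺ˡ; ++⁺ʳ; reverse⁺; take-⊆; filter-⊆; All-resp-⊆)
open import Data.List.Relation.Unary.All using (All; []; _∷_; tabulate)
import Data.List.Relation.Unary.All as All
open import Data.List.Relation.Unary.All.Properties using (++⁻ˡ; ++⁻ʳ)
open import Data.List.Relation.Unary.AllPairs using ([]; _∷_)
open import Data.List.Relation.Unary.Any using (here; there)
import Data.List.Relation.Unary.Any.Properties as Any
open import Data.List.Relation.Unary.Unique.Propositional using (Unique)
open import Data.List.Relation.Unary.Unique.Propositional.Properties using (upTo⁺)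
import Data.List.Relation.Unary.Unique.Propositional.Properties as Unique
open import Data.Nat using (ℕ; zero; suc; _+_; _*_; _∸_; _⊓_; _≤_; z≤n; s≤s; _≟_)
import Data.Nat.ListAction as List
open import Data.Nat.ListAction.Properties using (sum-++)
open import Data.Nat.Properties
open import Data.Nat.Tactic.RingSolver using (solve-∀)
open import Data.List.Membership.DecPropositional _≟_ using (_∈?_)
open import Data.Product using (∃; ∃₂; _×_; _,_; proj₂)
open import Data.Sum using (_⊎_; inj₁; inj₂)
open import Data.Vec using (Vec; []; _∷_; toList; lookup; sum)
open import Function using (_∘_)
open import Relation.Nullary using (yes; no)
open import Relation.Unary.Properties using (∁?)
open import Relation.Binary.PropositionalEquality
  using (_≡_; _≢_; refl; sym; trans; cong; cong₂; subst; subst₂; setoid; module ≡-Reasoning)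

esBound : ℕ → ℕ → ℕ
esBound zero    _       = 0
esBound (suc x) zero    = 0
esBound (suc x) (suc y) = suc (esBound x (suc y) + esBound (suc x) y)

+≤+⇒≤⊎≤ : ∀ a b c d → a + b ≤ c + d → a ≤ c ⊎ b ≤ d
+≤+⇒≤⊎≤ a b c d a+b≤c+d with a ≤? c | b ≤? d
... | yes a≤c | _       = inj₁ a≤c
... | no  _   | yes b≤d = inj₂ b≤d
... | no  a≰c | no  b≰d = ⊥-elim (<⇒≱ (+-mono-< (≰⇒> a≰c) (≰⇒> b≰d)) a+b≤c+d)

Unique-resp-⊇ : ∀ {xs ys : Seq} → xs ⊆ ys → Unique ys → Unique xs
Unique-resp-⊇ []           []       = []
Unique-resp-⊇ (y ∷ʳ xs⊆ys) (_ ∷ u)  = Unique-resp-⊇ xs⊆ys u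
Unique-resp-⊇ (refl ∷ xs⊆ys) (y∉ ∷ u) = All-resp-⊆ xs⊆ys y∉ ∷ Unique-resp-⊇ xs⊆ys u

Unique-reverse : ∀ {xs : Seq} → Unique xs → Unique (reverse xs)
Unique-reverse {xs} = Unique-resp-↭ (setoid ℕ) (↭⇒↭ₛ (↭-sym (↭-reverse xs)))

length-filter+filter-∁ : ∀ (ys xs : Seq) →
  length (filter (_∈? ys) xs) + length (filter (∁? (_∈? ys)) xs) ≡ length xs
length-filter+filter-∁ ys []       = refl
length-filter+filter-∁ ys (x ∷ xs) with x ∈? ys
... | yes _ = cong suc (length-filter+filter-∁ ys xs)
... | no  _ = trans (+-suc _ _) (cong suc (length-filter+filter-∁ ys xs))

∈-split⇒∈-prefix : ∀ {z t : ℕ} (pre post : Seq) →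
  z ∈ pre ++ t ∷ post → z ≢ t → z ∉ post → z ∈ pre
∈-split⇒∈-prefix pre post z∈ z≢t z∉post with ∈-++⁻ pre z∈
... | inj₁ z∈pre         = z∈pre
... | inj₂ (here z≡t)    = ⊥-elim (z≢t z≡t)
... | inj₂ (there z∈post) = ⊥-elim (z∉post z∈post)

split-around : ∀ (pre : Seq) t (post T : Seq) → t ∉ T → (∀ {z} → z ∈ T → z ∈ pre ++ t ∷ post) →
  ∃₂ λ U V → U ⊆ T × V ⊆ T × length U + length V ≡ length T ×
    (∀ {z} → z ∈ U → z ∈ post) × (∀ {z} → z ∈ V → z ∈ pre)
split-around pre t post T t∉T T⊆q =
  filter after? T , filter (∁? after?) T , filter-⊆ after? T , filter-⊆ (∁? after?) T ,
  length-filter+filter-∁ post T , (λ z∈U → proj₂ (∈-filter⁻ after? {xs = T} z∈U)) , before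
  where
  after? = _∈? post
  before : ∀ {z} → z ∈ filter (∁? after?) T → z ∈ pre
  before z∈V with z∈T , z∉post ← ∈-filter⁻ (∁? after?) z∈V =
    ∈-split⇒∈-prefix pre post (T⊆q z∈T) (λ { refl → t∉T z∈T }) z∉post

MonotoneSubsequence : ℕ → ℕ → Seq → Seq → Set
MonotoneSubsequence x y T q =
  ∃ λ A → A ⊆ T × (x ≤ length A × A ⊆ q ⊎ y ≤ length A × reverse A ⊆ q)

erdős–szekeres : ∀ x y (T q : Seq) → Unique T → (∀ {z} → z ∈ T → z ∈ q) →
  esBound x y ≤ length T →
  MonotoneSubsequence x y T q
erdős–szekeres zero    _       T q _ _ _ = [] , minimum T , inj₁ (z≤n , minimum q)
erdős–szekeres (suc x) zero    T q _ _ _ = [] , minimum T , inj₂ (z≤n , minimum q)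
erdős–szekeres (suc x) (suc y) (t ∷ T) q (t∉T ∷ uniq) T⊆q (s≤s bound)
  with pre , post , refl ← ∈-∃++ (T⊆q (here refl))
  with U , V , U⊆T , V⊆T , |U|+|V| , U⊆post , V⊆pre ←
         split-around pre t post T (λ t∈T → All.lookup t∉T t∈T refl) (T⊆q ∘ there)
  with +≤+⇒≤⊎≤ _ _ (length U) (length V) (subst (_ ≤_) (sym |U|+|V|) bound)
... | inj₁ boundU = extend (erdős–szekeres x (suc y) U post (Unique-resp-⊇ U⊆T uniq) U⊆post boundU)
  where
  extend : MonotoneSubsequence x (suc y) U post →
    MonotoneSubsequence (suc x) (suc y) (t ∷ T) (pre ++ t ∷ post)
  extend (A , A⊆U , inj₁ (long , A⊆post)) =
    t ∷ A , refl ∷ ⊆-trans A⊆U U⊆T , inj₁ (s≤s long , ++⁺ˡ pre (refl ∷ A⊆post))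
  extend (A , A⊆U , inj₂ (long , Aʳ⊆post)) =
    A , t ∷ʳ ⊆-trans A⊆U U⊆T , inj₂ (long , ++⁺ˡ pre (t ∷ʳ Aʳ⊆post))
... | inj₂ boundV = extend (erdős–szekeres (suc x) y V pre (Unique-resp-⊇ V⊆T uniq) V⊆pre boundV)
  where
  extend : MonotoneSubsequence (suc x) y V pre →
    MonotoneSubsequence (suc x) (suc y) (t ∷ T) (pre ++ t ∷ post)
  extend (A , A⊆V , inj₁ (long , A⊆pre)) =
    A , t ∷ʳ ⊆-trans A⊆V V⊆T , inj₁ (long , ++⁺ʳ (t ∷ post) A⊆pre)
  extend (A , A⊆V , inj₂ (long , Aʳ⊆pre)) =
    t ∷ A , refl ∷ ⊆-trans A⊆V V⊆T ,
    inj₂ (s≤s long , subst (_⊆ pre ++ t ∷ post) (sym (unfold-reverse t A)) (++⁺ Aʳ⊆pre (refl ∷ minimum post)))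

MonotoneIn : Seq → Seq → Set
MonotoneIn A q = A ⊆ q ⊎ reverse A ⊆ q

MonotoneIn-resp-⊇ : ∀ {A B q : Seq} → B ⊆ A → MonotoneIn A q → MonotoneIn B q
MonotoneIn-resp-⊇ B⊆A (inj₁ A⊆q)  = inj₁ (⊆-trans B⊆A A⊆q)
MonotoneIn-resp-⊇ B⊆A (inj₂ Aʳ⊆q) = inj₂ (⊆-trans (reverse⁺ B⊆A) Aʳ⊆q)

monotone-subsequence : ∀ x (T q : Seq) → Unique T → (∀ {z} → z ∈ T → z ∈ q) →
  esBound x x ≤ length T →
  ∃ λ A → A ⊆ T × x ≤ length A × MonotoneIn A q
monotone-subsequence x T q uniq T⊆q bound with erdős–szekeres x x T q uniq T⊆q bound
... | A , A⊆T , inj₁ (long , A⊆q)  = A , A⊆T , long , inj₁ A⊆q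
... | A , A⊆T , inj₂ (long , Aʳ⊆q) = A , A⊆T , long , inj₂ Aʳ⊆q

commonBound : ℕ → ℕ → ℕ
commonBound c zero    = c
commonBound c (suc n) = esBound (commonBound c n) (commonBound c n)

common-monotone : ∀ c {L : Seq} (qs : List Seq) → All (_↭ L) qs →
  (T : Seq) → Unique T → (∀ {z} → z ∈ T → z ∈ L) → commonBound c (length qs) ≤ length T →
  ∃ λ A → A ⊆ T × length A ≡ c × All (MonotoneIn A) qs
common-monotone c [] [] T _ _ c≤|T| =
  take c T , take-⊆ c T , trans (length-take c T) (m≤n⇒m⊓n≡m c≤|T|) , []
common-monotone c (q ∷ qs) (q↭L ∷ qs↭L) T uniq T⊆L bound
  with A₀ , A₀⊆T , long , A₀-mono ←
         monotone-subsequence _ T q uniq (λ z∈T → ∈-resp-↭ (↭-sym q↭L) (T⊆L z∈T)) bound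
  with A , A⊆A₀ , |A| , A-monos ←
         common-monotone c qs qs↭L A₀ (Unique-resp-⊇ A₀⊆T uniq) (T⊆L ∘ Sublist.lookup A₀⊆T) long
  = A , ⊆-trans A⊆A₀ A₀⊆T , |A| , MonotoneIn-resp-⊇ A⊆A₀ A₀-mono ∷ A-monos

pigeonhole-pow : ∀ {A B : Seq} (qs : List Seq) → All (λ q → A ⊆ q ⊎ B ⊆ q) qs →
  ∀ a b → length qs ≡ suc (a + b) → pow A (suc a) ⊆ concat qs ⊎ pow B (suc b) ⊆ concat qs
pigeonhole-pow (q ∷ qs) (inj₁ A⊆q ∷ _) zero _ _ = inj₁ (++⁺ A⊆q (minimum _))
pigeonhole-pow (q ∷ qs) (inj₁ A⊆q ∷ rest) (suc a) b |qs|
  with pigeonhole-pow qs rest a b (suc-injective |qs|)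
... | inj₁ Aᵃ⊆qs = inj₁ (++⁺ A⊆q Aᵃ⊆qs)
... | inj₂ Bᵇ⊆qs = inj₂ (++⁺ˡ q Bᵇ⊆qs)
pigeonhole-pow (q ∷ qs) (inj₂ B⊆q ∷ _) _ zero _ = inj₂ (++⁺ B⊆q (minimum _))
pigeonhole-pow (q ∷ qs) (inj₂ B⊆q ∷ rest) a (suc b) |qs|
  with pigeonhole-pow qs rest a b (trans (suc-injective |qs|) (+-suc a b))
... | inj₁ Aᵃ⊆qs = inj₁ (++⁺ˡ q Aᵃ⊆qs)
... | inj₂ Bᵇ⊆qs = inj₂ (++⁺ B⊆q Bᵇ⊆qs)

repeated-pattern : ∀ c e {L : Seq} (qs : List Seq) → All (_↭ L) qs → length qs ≡ suc (e + e) →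
  Unique L → commonBound c (length qs) ≤ length L →
  ∃ λ P → Unique P × length P ≡ c × (∀ {z} → z ∈ P → z ∈ L) × pow P (suc e) ⊆ concat qs
repeated-pattern c e qs qs↭L |qs| uniq bound
  with A , A⊆L , |A| , A-monos ← common-monotone c qs qs↭L _ uniq (λ z∈L → z∈L) bound
  with pigeonhole-pow qs A-monos e e |qs|
... | inj₁ Aᵉ⊆qs = A , Unique-resp-⊇ A⊆L uniq , |A| , Sublist.lookup A⊆L , Aᵉ⊆qs
... | inj₂ Aʳᵉ⊆qs = reverse A , Unique-reverse (Unique-resp-⊇ A⊆L uniq) , trans (length-reverse A) |A| ,
                    Sublist.lookup A⊆L ∘ Any.reverse⁻ , Aʳᵉ⊆qs

⊆-concat-↭ : ∀ {L} (w : Seq) (qs : List Seq) → (∀ {z} → z ∈ w → z ∈ L) → All (_↭ L) qs →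
  length w ≤ length qs → w ⊆ concat qs
⊆-concat-↭ []      qs       _   _              _         = minimum _
⊆-concat-↭ (z ∷ w) (q ∷ qs) w⊆L (q↭L ∷ qs↭L) (s≤s |w|≤) =
  ++⁺ (from∈ (∈-resp-↭ (↭-sym q↭L) (w⊆L (here refl))))
      (⊆-concat-↭ w qs (w⊆L ∘ there) qs↭L |w|≤)

rename : Seq → Seq → ℕ → ℕ
rename (w ∷ W) (p ∷ P) y with w ≟ y
... | yes _ = p
... | no  _ = rename W P y
rename _       _       y = y

rename-here : ∀ {w p : ℕ} {W P : Seq} → rename (w ∷ W) (p ∷ P) w ≡ p
rename-here {w} with w ≟ w
... | yes _   = refl
... | no  w≢w = ⊥-elim (w≢w refl)

rename-there : ∀ {w p y : ℕ} {W P : Seq} → w ≢ y → rename (w ∷ W) (p ∷ P) y ≡ rename W P y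
rename-there {w} {y = y} w≢y with w ≟ y
... | yes w≡y = ⊥-elim (w≢y w≡y)
... | no  _   = refl

rename-∈ : ∀ {W P : Seq} {y} → length W ≡ length P → y ∈ W → rename W P y ∈ P
rename-∈ {w ∷ W} {p ∷ P} {y} |W| y∈W with w ≟ y | y∈W
... | yes _   | _          = here refl
... | no  w≢y | here refl  = ⊥-elim (w≢y refl)
... | no  _   | there y∈W′ = there (rename-∈ (suc-injective |W|) y∈W′)

map-rename : ∀ {W P : Seq} → Unique W → length W ≡ length P → map (rename W P) W ≡ P
map-rename {[]}    {[]}    _            _   = refl
map-rename {w ∷ W} {p ∷ P} (w∉W ∷ uniq) |W| =
  cong₂ _∷_ (rename-here {w} {p} {W} {P})
    (trans (map-cong-local (All.map rename-there w∉W)) (map-rename uniq (suc-injective |W|)))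

rename-inverse : ∀ {W P : Seq} {y} → Unique P → length W ≡ length P → y ∈ W →
  rename P W (rename W P y) ≡ y
rename-inverse {w ∷ W} {p ∷ P} {y} (p∉P ∷ uniq) |W| y∈W with w ≟ y | y∈W
... | yes refl | _          = rename-here {p} {w} {P} {W}
... | no  w≢y  | here refl  = ⊥-elim (w≢y refl)
... | no  _    | there y∈W′ =
  trans (rename-there (All.lookup p∉P (rename-∈ (suc-injective |W|) y∈W′)))
        (rename-inverse uniq (suc-injective |W|) y∈W′)

contains-image : ∀ {s u : Seq} (g f : ℕ → ℕ) → map g u ⊆ s → (∀ {i} → i ∈ u → f (g i) ≡ i) →
  Contains s u
contains-image {u = u} g f image⊆s f∘g≡id = map g u , image⊆s , f , injective ,
  trans (sym (map-∘ u)) (map-id-local (tabulate f∘g≡id))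
  where
  injective : ∀ {x y} → x ∈ map g u → y ∈ map g u → f x ≡ f y → x ≡ y
  injective x∈ y∈ fx≡fy with i , i∈u , refl ← ∈-map⁻ g x∈ | j , j∈u , refl ← ∈-map⁻ g y∈ =
    cong g (trans (sym (f∘g≡id i∈u)) (trans fx≡fy (f∘g≡id j∈u)))

split-by-length : ∀ {A : Set} a b (xs : List A) → length xs ≡ a + b →
  ∃₂ λ ys zs → xs ≡ ys ++ zs × length ys ≡ a × length zs ≡ b
split-by-length a b xs |xs| =
  take a xs , drop a xs , sym (take++drop≡id a xs) ,
  trans (length-take a xs) (trans (cong (a ⊓_) |xs|) (m≤n⇒m⊓n≡m (m≤m+n a b))) ,
  trans (length-drop a xs) (trans (cong (_∸ a) |xs|) (m+n∸m≡n a b))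

block : Bool → ℕ → Seq
block true  = I
block false = D

length-block : ∀ b c → length (block b c) ≡ c
length-block true  c = trans (length-map suc (upTo c)) (length-upTo c)
length-block false c = trans (length-reverse (I c)) (length-block true c)

Unique-block : ∀ b c → Unique (block b c)
Unique-block true  c = Unique.map⁺ suc-injective (upTo⁺ c)
Unique-block false c = Unique-reverse (Unique-block true c)

∈-block⇒∈-I : ∀ b c {x} → x ∈ block b c → x ∈ I c
∈-block⇒∈-I true  c x∈ = x∈
∈-block⇒∈-I false c x∈ = Any.reverse⁻ x∈

∈-I⇒∈-block : ∀ b c {x} → x ∈ I c → x ∈ block b c
∈-I⇒∈-block true  c x∈ = x∈
∈-I⇒∈-block false c x∈ = Any.reverse⁺ x∈

∈-pow : ∀ (w : Seq) e {x} → x ∈ pow w e → x ∈ w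
∈-pow w (suc e) x∈ with ∈-++⁻ w x∈
... | inj₁ x∈w  = x∈w
... | inj₂ x∈wᵉ = ∈-pow w e x∈wᵉ

length-pow : ∀ (w : Seq) e → length (pow w e) ≡ e * length w
length-pow w zero    = refl
length-pow w (suc e) = trans (length-++ w) (cong (length w +_) (length-pow w e))

map-pow : ∀ (g : ℕ → ℕ) (w : Seq) e → map g (pow w e) ≡ pow (map g w) e
map-pow g w zero    = refl
map-pow g w (suc e) = trans (map-++ g w (pow w e)) (cong (map g w ++_) (map-pow g w e))

alt-∷ : ∀ c b e es → alt c b (e ∷ es) ≡ pow (block b c) e ++ alt c (not b) es
alt-∷ c true  e es = refl
alt-∷ c false e es = refl

alt-split : ∀ c b (pre : List ℕ) e post →
  ∃ λ b′ → alt c b (pre ++ e ∷ post) ≡ alt c b pre ++ pow (block b′ c) e ++ alt c (not b′) post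
alt-split c b []        e post = b , alt-∷ c b e post
alt-split c b (x ∷ pre) e post with b′ , split ← alt-split c (not b) pre e post = b′ , (begin
  alt c b (x ∷ pre ++ e ∷ post)                         ≡⟨ alt-∷ c b x (pre ++ e ∷ post) ⟩
  pow (block b c) x ++ alt c (not b) (pre ++ e ∷ post)  ≡⟨ cong (pow (block b c) x ++_) split ⟩
  pow (block b c) x ++ alt c (not b) pre ++ rest        ≡⟨ ++-assoc (pow (block b c) x) _ rest ⟨
  (pow (block b c) x ++ alt c (not b) pre) ++ rest      ≡⟨ cong (_++ rest) (alt-∷ c b x pre) ⟨
  alt c b (x ∷ pre) ++ rest                             ∎)
  where
  open ≡-Reasoning
  rest = pow (block b′ c) e ++ alt c (not b′) post

∈-alt⇒∈-I : ∀ c b es {x} → x ∈ alt c b es → x ∈ I c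
∈-alt⇒∈-I c b (e ∷ es) x∈ with ∈-++⁻ (pow (block b c) e) (subst (_ ∈_) (alt-∷ c b e es) x∈)
... | inj₁ x∈blockᵉ = ∈-block⇒∈-I b c (∈-pow (block b c) e x∈blockᵉ)
... | inj₂ x∈rest   = ∈-alt⇒∈-I c (not b) es x∈rest

length-alt : ∀ c b es → length (alt c b es) ≡ c * List.sum es
length-alt c b []       = sym (*-zeroʳ c)
length-alt c b (e ∷ es) = begin
  length (alt c b (e ∷ es))                                   ≡⟨ cong length (alt-∷ c b e es) ⟩
  length (pow (block b c) e ++ alt c (not b) es)              ≡⟨ length-++ (pow (block b c) e) ⟩
  length (pow (block b c) e) + length (alt c (not b) es)      ≡⟨ cong₂ _+_ (length-pow (block b c) e) (length-alt c (not b) es) ⟩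
  e * length (block b c) + c * List.sum es                    ≡⟨ cong (λ n → e * n + c * List.sum es) (length-block b c) ⟩
  e * c + c * List.sum es                                     ≡⟨ cong (_+ c * List.sum es) (*-comm e c) ⟩
  c * e + c * List.sum es                                     ≡⟨ *-distribˡ-+ c e (List.sum es) ⟨
  c * (e + List.sum es)                                       ∎
  where open ≡-Reasoning

every-formation-contains : ∀ c pre e post →
  AllFormationsContain (commonBound c (suc (e + e))) (c * List.sum pre + (suc (e + e) + c * List.sum post))
    (altWord c (pre ++ suc e ∷ post))
every-formation-contains c pre e post _ (L , |L| , uniqL , ps , |ps| , ps↭L , refl)
  with ps₁ , ps₂₃ , refl , |ps₁| , |ps₂₃| ← split-by-length (c * List.sum pre) _ ps |ps|
  with ps₂ , ps₃ , refl , |ps₂| , |ps₃| ← split-by-length (suc (e + e)) _ ps₂₃ |ps₂₃|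
  with b , u≡ ← alt-split c true pre (suc e) post
  with repeated-pattern c e ps₂ (++⁻ˡ ps₂ (++⁻ʳ ps₁ ps↭L)) |ps₂| uniqL
         (≤-reflexive (trans (cong (commonBound c) |ps₂|) (sym |L|)))
... | P , uniqP , |P| , P⊆L , Pᵉ⊆ps₂ = contains-image g f image⊆ inverse
  where
  W = block b c
  g = rename W P
  f = rename P W

  |W|≡|P| : length W ≡ length P
  |W|≡|P| = trans (length-block b c) (sym |P|)

  g-∈-L : ∀ b′ es {z} → z ∈ map g (alt c b′ es) → z ∈ L
  g-∈-L b′ es z∈ with i , i∈ , refl ← ∈-map⁻ g z∈ =
    P⊆L (rename-∈ |W|≡|P| (∈-I⇒∈-block b c (∈-alt⇒∈-I c b′ es i∈)))

  spread : ∀ b′ es (qs : List Seq) → All (_↭ L) qs → length qs ≡ c * List.sum es →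
    map g (alt c b′ es) ⊆ concat qs
  spread b′ es qs qs↭L |qs| = ⊆-concat-↭ _ qs (g-∈-L b′ es) qs↭L
    (≤-reflexive (trans (length-map g (alt c b′ es)) (trans (length-alt c b′ es) (sym |qs|))))

  image⊆ : map g (altWord c (pre ++ suc e ∷ post)) ⊆ concat (ps₁ ++ ps₂ ++ ps₃)
  image⊆ = subst₂ _⊆_ (sym image≡) concat≡
    (++⁺ (spread true pre ps₁ (++⁻ˡ ps₁ ps↭L) |ps₁|)
      (++⁺ Pᵉ⊆ps₂ (spread (not b) post ps₃ (++⁻ʳ ps₂ (++⁻ʳ ps₁ ps↭L)) |ps₃|)))
    where
    open ≡-Reasoning
    X = alt c true pre
    Y = alt c (not b) post
    image≡ : map g (altWord c (pre ++ suc e ∷ post)) ≡ map g X ++ pow P (suc e) ++ map g Y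
    image≡ = begin
      map g (altWord c (pre ++ suc e ∷ post))          ≡⟨ cong (map g) u≡ ⟩
      map g (X ++ pow W (suc e) ++ Y)                  ≡⟨ map-++ g X _ ⟩
      map g X ++ map g (pow W (suc e) ++ Y)            ≡⟨ cong (map g X ++_) (map-++ g (pow W (suc e)) Y) ⟩
      map g X ++ map g (pow W (suc e)) ++ map g Y      ≡⟨ cong (λ v → map g X ++ v ++ map g Y) (map-pow g W (suc e)) ⟩
      map g X ++ pow (map g W) (suc e) ++ map g Y      ≡⟨ cong (λ v → map g X ++ pow v (suc e) ++ map g Y) (map-rename (Unique-block b c) |W|≡|P|) ⟩
      map g X ++ pow P (suc e) ++ map g Y              ∎
    concat≡ : concat ps₁ ++ concat ps₂ ++ concat ps₃ ≡ concat (ps₁ ++ ps₂ ++ ps₃)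
    concat≡ = trans (cong (concat ps₁ ++_) (concat-++ ps₂ ps₃)) (concat-++ ps₁ (ps₂ ++ ps₃))

  inverse : ∀ {i} → i ∈ altWord c (pre ++ suc e ∷ post) → f (g i) ≡ i
  inverse i∈ =
    rename-inverse uniqP |W|≡|P| (∈-I⇒∈-block b c (∈-alt⇒∈-I c true (pre ++ suc e ∷ post) i∈))

fw-altWord : ∀ c pre e post → 1 ≤ e →
  FwAtMost (altWord c (pre ++ e ∷ post)) (c * (List.sum pre + List.sum post) + 2 * e ∸ 1)
fw-altWord c pre (suc e) post _ =
  _ , ≤-reflexive count , _ , every-formation-contains c pre e post
  where
  rearrange : ∀ c a b e → c * a + (suc (e + e) + c * b) ≡ c * (a + b) + (e + suc (e + 0))
  rearrange = solve-∀
  -- 2 * suc e unfolds to suc (e + suc (e + 0)), so +-suc exposes the suc that ∸ 1 removes.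
  count : c * List.sum pre + (suc (e + e) + c * List.sum post)
        ≡ c * (List.sum pre + List.sum post) + 2 * suc e ∸ 1
  count = trans (rearrange c (List.sum pre) (List.sum post) e)
                (sym (cong (_∸ 1) (+-suc (c * (List.sum pre + List.sum post)) _)))

toList-split : ∀ {n} (xs : Vec ℕ n) (i : Fin n) →
  ∃₂ λ pre post → toList xs ≡ pre ++ lookup xs i ∷ post
toList-split (x ∷ xs) zero    = [] , toList xs , refl
toList-split (x ∷ xs) (suc i) with pre , post , split ← toList-split xs i =
  x ∷ pre , post , cong (x ∷_) split

sum-toList : ∀ {n} (xs : Vec ℕ n) → sum xs ≡ List.sum (toList xs)
sum-toList []       = refl
sum-toList (x ∷ xs) = cong (x +_) (sum-toList xs)

lemma2p9 : (c n : ℕ) → 1 ≤ c → 1 ≤ n → (es : Vec ℕ n) → (∀ i → 1 ≤ lookup es i) →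
    (k : ℕ) → sum es ≡ k → (m : Fin n) →
    FwAtMost (altWord c (toList es)) (c * (k ∸ lookup es m) + 2 * lookup es m ∸ 1)
lemma2p9 c _ _ _ es positive _ refl m with pre , post , split ← toList-split es m =
  subst₂ (λ es′ s → FwAtMost (altWord c es′) (c * s + 2 * lookup es m ∸ 1)) (sym split) (sym remaining-sum)
    (fw-altWord c pre (lookup es m) post (positive m))
  where
  e = lookup es m
  remaining-sum : sum es ∸ e ≡ List.sum pre + List.sum post
  remaining-sum = begin
    sum es ∸ e                                       ≡⟨ cong (_∸ e) (sum-toList es) ⟩
    List.sum (toList es) ∸ e                         ≡⟨ cong (λ xs → List.sum xs ∸ e) split ⟩
    List.sum (pre ++ e ∷ post) ∸ e                   ≡⟨ cong (_∸ e) (sum-++ pre (e ∷ post)) ⟩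
    List.sum pre + (e + List.sum post) ∸ e           ≡⟨ cong (_∸ e) (x∙yz≈y∙xz +-commutativeSemigroup (List.sum pre) e (List.sum post)) ⟩
    e + (List.sum pre + List.sum post) ∸ e           ≡⟨ m+n∸m≡n e _ ⟩
    List.sum pre + List.sum post                     ∎
    where open ≡-Reasoning
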